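{- For every integer $j$ and every integer $k$, $$ s_k(j^2-2)=r_k(j)\, s_k(j), $$ where $(r_k(j))_k$ satisfies the same recurrence as $(s_k(j))_k$, namely $r_{k+2}(j)-j\,r_{k+1}(j)+r_k(j)=0$, with initial values $r_0(j)=1$, $r_1(j)=j-1$. Thus $s_k(j^2-2)$ is expressed as a product of two integers.
   Context: For an integer $n$, the sequence $(s_k(n))_{k\in\mathbb{Z}}$ is defined by $s_0(n)=1$, $s_1(n)=n+1$ and $s_{k+2}(n)=n\,s_{k+1}(n)-s_k(n)$ for all $k\in\mathbb{Z}$; $(r_k(n))_{k\in\mathbb{Z}}$ is defined by the same recurrence with $r_0(n)=1$, $r_1(n)=n-1$. -}

module Defs where

open import Data.Nat using (ℕ; zero; suc)
open import Data.Integer using (ℤ; +_; -[1+_]; _+_; _*_; _-_)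
open import Data.Product using (_×_; _,_; proj₁)

fwdPair : ℤ → ℤ → ℤ → ℕ → ℤ × ℤ
fwdPair n a b zero    = a , b
fwdPair n a b (suc m) with fwdPair n a b m
... | (x , y) = y , n * y - x

fwd : ℤ → ℤ → ℤ → ℕ → ℤ
fwd n a b m = proj₁ (fwdPair n a b m)

-- The unique two-sided sequence (u_k)_{k ∈ ℤ} with u_0 = a, u_1 = b and
-- u_{k+2} = n u_{k+1} - u_k for all k ∈ ℤ.  Negative indices: the recurrence
-- run backwards, u_{-m} satisfies the same recurrence with u_0 = a,
-- u_{-1} = n a - b.
recSeq : ℤ → ℤ → ℤ → ℤ → ℤ
recSeq n a b (+ m)      = fwd n a b m
recSeq n a b -[1+ m ]   = fwd n a (n * a - b) (suc m)

s : ℤ → ℤ → ℤ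
s k n = recSeq n (+ 1) (n + + 1) k

r : ℤ → ℤ → ℤ
r k n = recSeq n (+ 1) (n - + 1) k

{-# OPTIONS --safe #-}
-- If α + α⁻¹ = n, the solutions of u(m+2) = n u(m+1) − u(m) are the
-- combinations of α^m and α^-m, so products of two of them are combinations
-- of α^2m, 1 and α^-2m.  These, like the solutions of the same recurrence for
-- N = α² + α⁻² = n² − 2, satisfy the third-order recurrence with characteristic
-- polynomial (t − 1)(t² − N t + 1).  Hence s(n² − 2) and r(n) s(n) agree once
-- their first three terms do.  Negative indices reduce to non-negative ones
-- through s₋₁₋ₘ = −sₘ and r₋₁₋ₘ = rₘ.
module Submission where

open import Defs
open import Data.Nat using (ℕ; zero; suc)
open import Data.Integer using (ℤ; +_; -[1+_]; _*_; _-_; _+_; -_)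
open import Data.Integer.Properties using (neg-distribʳ-*)
open import Data.Integer.Tactic.RingSolver using (solve-∀)
open import Data.Product using (_×_; _,_; proj₁)
open import Function using (_∘_)
open import Relation.Binary.PropositionalEquality using (_≡_; refl; trans; cong; cong₂; module ≡-Reasoning)

record Recurrent (n : ℤ) (u : ℕ → ℤ) : Set where
  constructor recurrent
  field step : ∀ m → u (suc (suc m)) ≡ n * u (suc m) - u m

record Recurrent₃ (N : ℤ) (u : ℕ → ℤ) : Set where
  constructor recurrent₃
  field step₃ : ∀ m → u (suc (suc (suc m))) ≡ (N + + 1) * (u (suc (suc m)) - u (suc m)) + u m

open Recurrent
open Recurrent₃

fwd-step : ∀ n a b m → fwd n a b (suc (suc m)) ≡ n * fwd n a b (suc m) - fwd n a b m
fwd-step n a b m with fwdPair n a b m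
... | _ , _ = refl

fwd-recurrent : ∀ n a b → Recurrent n (fwd n a b)
fwd-recurrent n a b = recurrent (fwd-step n a b)

recurrent-suc : ∀ {n u} → Recurrent n u → Recurrent n (u ∘ suc)
recurrent-suc (recurrent rec) = recurrent (rec ∘ suc)

recurrent-neg : ∀ {n u} → Recurrent n u → Recurrent n (-_ ∘ u)
recurrent-neg {n} {u} (recurrent rec) = recurrent λ m → begin
  - u (suc (suc m))             ≡⟨ cong -_ (rec m) ⟩
  - (n * u (suc m) - u m)       ≡⟨ negate n (u m) (u (suc m)) ⟩
  n * - u (suc m) - - u m       ∎
  where
  open ≡-Reasoning
  negate : ∀ n x y → - (n * y - x) ≡ n * - y - - x
  negate = solve-∀

recurrent-unique : ∀ {n u v} → Recurrent n u → Recurrent n v →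
                   u 0 ≡ v 0 → u 1 ≡ v 1 → ∀ m → u m ≡ v m
recurrent-unique {n} {u} {v} (recurrent recᵤ) (recurrent recᵥ) u₀ u₁ m = proj₁ (agree m)
  where
  agree : ∀ m → u m ≡ v m × u (suc m) ≡ v (suc m)
  agree zero    = u₀ , u₁
  agree (suc m) with agree m
  ... | eq₀ , eq₁ = eq₁ , (begin
    u (suc (suc m))           ≡⟨ recᵤ m ⟩
    n * u (suc m) - u m       ≡⟨ cong₂ (λ y x → n * y - x) eq₁ eq₀ ⟩
    n * v (suc m) - v m       ≡⟨ recᵥ m ⟨
    v (suc (suc m))           ∎)
    where open ≡-Reasoning

recurrent₃-unique : ∀ {N u v} → Recurrent₃ N u → Recurrent₃ N v →
                    u 0 ≡ v 0 → u 1 ≡ v 1 → u 2 ≡ v 2 → ∀ m → u m ≡ v m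
recurrent₃-unique {N} {u} {v} (recurrent₃ recᵤ) (recurrent₃ recᵥ) u₀ u₁ u₂ m = proj₁ (agree m)
  where
  agree : ∀ m → u m ≡ v m × u (suc m) ≡ v (suc m) × u (suc (suc m)) ≡ v (suc (suc m))
  agree zero    = u₀ , u₁ , u₂
  agree (suc m) with agree m
  ... | eq₀ , eq₁ , eq₂ = eq₁ , eq₂ , (begin
    u (suc (suc (suc m)))                                      ≡⟨ recᵤ m ⟩
    (N + + 1) * (u (suc (suc m)) - u (suc m)) + u m            ≡⟨ cong₂ (λ z x → (N + + 1) * z + x)
                                                                        (cong₂ _-_ eq₂ eq₁) eq₀ ⟩
    (N + + 1) * (v (suc (suc m)) - v (suc m)) + v m            ≡⟨ recᵥ m ⟨
    v (suc (suc (suc m)))                                      ∎)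
    where open ≡-Reasoning

recurrent-three-steps : ∀ {n u} → Recurrent n u →
                        ∀ m → u (suc (suc (suc m))) ≡ n * (n * u (suc m) - u m) - u (suc m)
recurrent-three-steps {n} {u} (recurrent rec) m = trans (rec (suc m)) (cong (λ y → n * y - u (suc m)) (rec m))

recurrent⇒recurrent₃ : ∀ {N u} → Recurrent N u → Recurrent₃ N u
step₃ (recurrent⇒recurrent₃ {N} {u} rec) m = begin
  u (suc (suc (suc m)))                                          ≡⟨ recurrent-three-steps rec m ⟩
  N * (N * u₁ - u₀) - u₁                                         ≡⟨ identity N u₀ u₁ ⟩
  (N + + 1) * ((N * u₁ - u₀) - u₁) + u₀                          ≡⟨ cong (λ y → (N + + 1) * (y - u₁) + u₀) (step rec m) ⟨
  (N + + 1) * (u (suc (suc m)) - u₁) + u₀                        ∎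
  where
  open ≡-Reasoning
  u₀ = u m
  u₁ = u (suc m)
  identity : ∀ N x y → N * (N * y - x) - y ≡ (N + + 1) * ((N * y - x) - y) + x
  identity = solve-∀

recurrent-product : ∀ {n x y} → Recurrent n x → Recurrent n y →
                    Recurrent₃ (n * n - + 2) (λ m → x m * y m)
step₃ (recurrent-product {n} {x} {y} recₓ recᵧ) m = begin
  x (suc (suc (suc m))) * y (suc (suc (suc m)))
    ≡⟨ cong₂ _*_ (recurrent-three-steps recₓ m) (recurrent-three-steps recᵧ m) ⟩
  (n * (n * x₁ - x₀) - x₁) * (n * (n * y₁ - y₀) - y₁)
    ≡⟨ identity n x₀ x₁ y₀ y₁ ⟩
  (n * n - + 2 + + 1) * ((n * x₁ - x₀) * (n * y₁ - y₀) - x₁ * y₁) + x₀ * y₀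
    ≡⟨ cong (λ p → (n * n - + 2 + + 1) * (p - x₁ * y₁) + x₀ * y₀) (cong₂ _*_ (step recₓ m) (step recᵧ m)) ⟨
  (n * n - + 2 + + 1) * (x (suc (suc m)) * y (suc (suc m)) - x₁ * y₁) + x₀ * y₀
    ∎
  where
  open ≡-Reasoning
  x₀ = x m
  x₁ = x (suc m)
  y₀ = y m
  y₁ = y (suc m)
  identity : ∀ n x₀ x₁ y₀ y₁ →
             (n * (n * x₁ - x₀) - x₁) * (n * (n * y₁ - y₀) - y₁) ≡
             (n * n - + 2 + + 1) * ((n * x₁ - x₀) * (n * y₁ - y₀) - x₁ * y₁) + x₀ * y₀
  identity = solve-∀

s-factorisation-nonneg : ∀ j m → s (+ m) (j * j - + 2) ≡ r (+ m) j * s (+ m) j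
s-factorisation-nonneg j =
  recurrent₃-unique (recurrent⇒recurrent₃ (fwd-recurrent _ _ _))
                    (recurrent-product (fwd-recurrent _ _ _) (fwd-recurrent _ _ _))
                    refl (at₁ j) (at₂ j)
  where
  at₁ : ∀ j → (j * j - + 2) + + 1 ≡ (j - + 1) * (j + + 1)
  at₁ = solve-∀
  at₂ : ∀ j → (j * j - + 2) * ((j * j - + 2) + + 1) - + 1 ≡
                 (j * (j - + 1) - + 1) * (j * (j + + 1) - + 1)
  at₂ = solve-∀

s-negative : ∀ n m → s -[1+ m ] n ≡ - s (+ m) n
s-negative n =
  recurrent-unique (recurrent-suc (fwd-recurrent _ _ _)) (recurrent-neg (fwd-recurrent _ _ _))
                   (at₀ n) (at₁ n)
  where
  at₀ : ∀ n → n * + 1 - (n + + 1) ≡ - + 1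
  at₀ = solve-∀
  at₁ : ∀ n → n * (n * + 1 - (n + + 1)) - + 1 ≡ - (n + + 1)
  at₁ = solve-∀

r-negative : ∀ n m → r -[1+ m ] n ≡ r (+ m) n
r-negative n =
  recurrent-unique (recurrent-suc (fwd-recurrent _ _ _)) (fwd-recurrent _ _ _)
                   (at₀ n) (at₁ n)
  where
  at₀ : ∀ n → n * + 1 - (n - + 1) ≡ + 1
  at₀ = solve-∀
  at₁ : ∀ n → n * (n * + 1 - (n - + 1)) - + 1 ≡ n - + 1
  at₁ = solve-∀

theorem11 : (j k : ℤ) → s k (j * j - + 2) ≡ r k j * s k j
theorem11 j (+ m)    = s-factorisation-nonneg j m
theorem11 j -[1+ m ] = begin
  s -[1+ m ] (j * j - + 2)        ≡⟨ s-negative (j * j - + 2) m ⟩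
  - s (+ m) (j * j - + 2)         ≡⟨ cong -_ (s-factorisation-nonneg j m) ⟩
  - (r (+ m) j * s (+ m) j)       ≡⟨ neg-distribʳ-* (r (+ m) j) (s (+ m) j) ⟩
  r (+ m) j * - s (+ m) j         ≡⟨ cong₂ _*_ (r-negative j m) (s-negative j m) ⟨
  r -[1+ m ] j * s -[1+ m ] j     ∎
  where open ≡-Reasoning
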